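{- Let $(h(n))_{n\in\mathbb{N}}$ be defined by $h(n)=1$ for all integers $n\le 1$ and $h(n)=h(n-h(n-1))+h(n-2)$ for $n>1$. Then there is no polynomial $P\in\mathbb{Z}[x]$ such that $h(2n)=P(n)$ for infinitely many $n\in\mathbb{N}$. -}

module Defs where

open import Data.Integer using (ℤ; _+_; _-_; _*_; _≤_; _>_; +_; 0ℤ; 1ℤ)
open import Data.Nat using (ℕ) renaming (_≤_ to _≤ℕ_; _*_ to _*ℕ_)
open import Data.List using (List; []; _∷_)
open import Data.Product using (∃; _×_)
open import Relation.Binary.PropositionalEquality using (_≡_)

record IsH (h : ℤ → ℤ) : Set where
  field
    base : ∀ (n : ℤ) → n ≤ 1ℤ → h n ≡ 1ℤ
    step : ∀ (n : ℤ) → n > 1ℤ → h n ≡ h (n - h (n - 1ℤ)) + h (n - (+ 2))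

-- Polynomials in ℤ[x] as coefficient lists [a₀, a₁, …, a_d] (constant first).
Poly : Set
Poly = List ℤ

eval : Poly → ℤ → ℤ
eval []       x = 0ℤ
eval (a ∷ as) x = a + x * eval as x

InfinitelyMany : (ℕ → Set) → Set
InfinitelyMany P = ∀ (m : ℕ) → ∃ λ n → m ≤ℕ n × P n

{-# OPTIONS --safe #-}
-- Induction on k gives h(2k+1) = k+1 and h(2k) ≥ 2k; the latter forces the look-back index of
-- h(2k+3) to be ≤ 1. Hence h(2k+2) = h(k+1) + h(2k), so g(k) = h(2k) is strictly increasing with
-- g(m+1) + g(2m) ≤ g(2m+2). Iterating, q·g(q) ≤ g(n) whenever 4q ≤ n, and an induction on the degree
-- shows that g eventually beats every M(n+1)^d, whereas P(n) ≤ ‖P‖₁ (n+1)^(deg P + 1).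
module Submission where

open import Defs
open import Data.Integer as ℤ using (ℤ; +_; -[1+_]; ∣_∣; 1ℤ; +≤+; -≤+; +<+)
import Data.Integer.Properties as ℤₚ
open import Data.List using ([]; _∷_; length; map)
open import Data.Nat.ListAction using (sum)
open import Data.Nat using (ℕ; zero; suc; _+_; _*_; _^_; _≤_; _<_; _≤′_; ≤′-refl; ≤′-step; z≤n; s≤s)
open import Data.Nat.Properties
open import Data.Nat.DivMod using (_/_; _%_; m≡m%n+[m/n]*n; m%n<n; m*n/n≡m; /-monoˡ-≤)
open import Data.Nat.Induction using (<-rec)
open import Data.Nat.Tactic.RingSolver using (solve-∀)
open import Data.Product using (Σ; ∃; _×_; _,_; proj₁; proj₂)
open import Function using (_∘_)
open import Relation.Binary.PropositionalEquality
open import Relation.Nullary using (¬_)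

^-distrib-* : ∀ m n k → (m * n) ^ k ≡ m ^ k * n ^ k
^-distrib-* m n zero    = refl
^-distrib-* m n (suc k) = trans (cong (m * n *_) (^-distrib-* m n k)) (interchange m n (m ^ k) (n ^ k))
  where
  interchange : ∀ a b c d → a * b * (c * d) ≡ a * c * (b * d)
  interchange = solve-∀

Superpolynomial : (ℕ → ℕ) → Set
Superpolynomial f = ∀ d M → ∃ λ N → ∀ n → N ≤ n → M * suc n ^ d < f n

module _ (f : ℕ → ℕ)
         (f-strict : ∀ n → f n < f (suc n))
         (f-doubling : ∀ m → f (suc m) + f (2 * m) ≤ f (2 * suc m)) where

  f-mono : ∀ {m n} → m ≤ n → f m ≤ f n
  f-mono {m} m≤n = go (≤⇒≤′ m≤n)
    where
    go : ∀ {n} → m ≤′ n → f m ≤ f n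
    go ≤′-refl        = ≤-refl
    go (≤′-step m≤′n) = ≤-trans (go m≤′n) (<⇒≤ (f-strict _))

  n≤f[n] : ∀ n → n ≤ f n
  n≤f[n] zero    = z≤n
  n≤f[n] (suc n) = ≤-trans (s≤s (n≤f[n] n)) (f-strict n)

  k*f[m]≤f[2[k+m]] : ∀ k m → k * f m ≤ f (2 * (k + m))
  k*f[m]≤f[2[k+m]] zero    m = z≤n
  k*f[m]≤f[2[k+m]] (suc k) m = begin
    f m + k * f m                     ≤⟨ +-mono-≤ (f-mono (m≤n+m m (suc k))) (k*f[m]≤f[2[k+m]] k m) ⟩
    f (suc k + m) + f (2 * (k + m))   ≤⟨ f-doubling (k + m) ⟩
    f (2 * suc (k + m))               ∎
    where open ≤-Reasoning

  q*f[q]≤f[n] : ∀ q n → q * 4 ≤ n → q * f q ≤ f n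
  q*f[q]≤f[n] q n 4q≤n = ≤-trans (k*f[m]≤f[2[k+m]] q q) (f-mono (subst (_≤ n) (quadruple q) 4q≤n))
    where
    quadruple : ∀ q → q * 4 ≡ 2 * (q + q)
    quadruple = solve-∀

  superpolynomial : Superpolynomial f
  superpolynomial zero M = suc M , λ n M<n → begin-strict
    M * 1  ≡⟨ *-identityʳ M ⟩
    M      <⟨ M<n ⟩
    n      ≤⟨ n≤f[n] n ⟩
    f n    ∎
    where open ≤-Reasoning
  superpolynomial (suc d) M = suc N * 4 , λ n 4[1+N]≤n →
    subst (λ n → M * suc n ^ suc d < f n) (sym (m≡m%n+[m/n]*n n 4))
          (dominated-at (n / 4) (n % 4) (m%n<n n 4) (N<n/4 4[1+N]≤n))
    where
    C : ℕ
    C = M * 4 ^ suc d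
    N : ℕ
    N = proj₁ (superpolynomial d (2 * C))

    N<n/4 : ∀ {n} → suc N * 4 ≤ n → N < n / 4
    N<n/4 {n} 4[1+N]≤n = subst (_≤ n / 4) (m*n/n≡m (suc N) 4) (/-monoˡ-≤ 4 4[1+N]≤n)

    rearrange : ∀ M A s Y → M * (s * Y * A) ≡ M * A * s * Y
    rearrange = solve-∀

    halve : ∀ C q Y → C * (q + q) * Y ≡ q * (2 * C * Y)
    halve = solve-∀

    -- With n = r + 4q, growth by a factor q between q and n beats the extra factor n + 1 ≤ 4(q + 1).
    dominated-at : ∀ q r → r < 4 → N < q → M * suc (r + q * 4) ^ suc d < f (r + q * 4)
    dominated-at q@(suc _) r r<4 N<q = begin-strict
      M * suc (r + q * 4) ^ suc d      ≤⟨ *-monoʳ-≤ M (^-monoˡ-≤ (suc d) (+-monoˡ-≤ (q * 4) r<4)) ⟩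
      M * (suc q * 4) ^ suc d          ≡⟨ cong (M *_) (^-distrib-* (suc q) 4 (suc d)) ⟩
      M * (suc q * Y * 4 ^ suc d)      ≡⟨ rearrange M (4 ^ suc d) (suc q) Y ⟩
      C * suc q * Y                    ≤⟨ *-monoˡ-≤ Y (*-monoʳ-≤ C (+-monoˡ-≤ q (s≤s z≤n))) ⟩
      C * (q + q) * Y                  ≡⟨ halve C q Y ⟩
      q * (2 * C * Y)                  <⟨ *-monoʳ-< q (proj₂ (superpolynomial d (2 * C)) q (<⇒≤ N<q)) ⟩
      q * f q                          ≤⟨ q*f[q]≤f[n] q (r + q * 4) (m≤n+m (q * 4) r) ⟩
      f (r + q * 4)                    ∎
      where
      open ≤-Reasoning
      Y : ℕ
      Y = suc q ^ d

evalAbs : Poly → ℕ → ℕ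
evalAbs []       n = 0
evalAbs (a ∷ as) n = ∣ a ∣ + n * evalAbs as n

norm₁ : Poly → ℕ
norm₁ P = sum (map ∣_∣ P)

i≤+∣i∣ : ∀ i → i ℤ.≤ + ∣ i ∣
i≤+∣i∣ (+ n)     = ℤₚ.≤-refl
i≤+∣i∣ -[1+ n ] = -≤+

eval≤evalAbs : ∀ P n → eval P (+ n) ℤ.≤ + evalAbs P n
eval≤evalAbs []       n = ℤₚ.≤-refl
eval≤evalAbs (a ∷ as) n = begin
  a ℤ.+ + n ℤ.* eval as (+ n)           ≤⟨ ℤₚ.+-mono-≤ (i≤+∣i∣ a) (ℤₚ.*-monoˡ-≤-nonNeg (+ n) (eval≤evalAbs as n)) ⟩
  + ∣ a ∣ ℤ.+ + n ℤ.* + evalAbs as n    ≡⟨ cong (ℤ._+_ (+ ∣ a ∣)) (ℤₚ.pos-* n (evalAbs as n)) ⟨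
  + evalAbs (a ∷ as) n                  ∎
  where open ℤₚ.≤-Reasoning

evalAbs≤norm₁*[1+n]^deg : ∀ P n → evalAbs P n ≤ norm₁ P * suc n ^ length P
evalAbs≤norm₁*[1+n]^deg []       n = z≤n
evalAbs≤norm₁*[1+n]^deg (a ∷ as) n = begin
  ∣ a ∣ + n * evalAbs as n                         ≤⟨ +-mono-≤ (m≤m*n ∣ a ∣ (suc n ^ suc (length as)) {{m^n≢0 (suc n) (suc (length as))}})
                                                              (*-mono-≤ (n≤1+n n) (evalAbs≤norm₁*[1+n]^deg as n)) ⟩
  ∣ a ∣ * (suc n * W) + suc n * (norm₁ as * W)     ≡⟨ factor ∣ a ∣ (norm₁ as) (suc n) W ⟩
  (∣ a ∣ + norm₁ as) * (suc n * W)                 ∎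
  where
  open ≤-Reasoning
  W : ℕ
  W = suc n ^ length as
  factor : ∀ a s x w → a * (x * w) + x * (s * w) ≡ (a + s) * (x * w)
  factor = solve-∀

-‿monoʳ-≥-≤ : ∀ i {j k} → k ℤ.≤ j → i ℤ.- j ℤ.≤ i ℤ.- k
-‿monoʳ-≥-≤ i k≤j = ℤₚ.+-monoʳ-≤ i (ℤₚ.neg-mono-≤ k≤j)

+[m+n]-+n≡+m : ∀ m n → + (m + n) ℤ.- + n ≡ + m
+[m+n]-+n≡+m m n = trans (ℤₚ.[+m]-[+n]≡m⊖n (m + n) n)
                         (trans (ℤₚ.⊖-≥ (m≤n+m n m)) (cong +_ (m+n∸n≡m m n)))

module Properties {h : ℤ → ℤ} (isH : IsH h) where
  open IsH isH

  h-step : ∀ n → h (+ (2 + n)) ≡ h (+ (2 + n) ℤ.- h (+ (1 + n))) ℤ.+ h (+ n)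
  h-step n = step (+ (2 + n)) (+<+ (s≤s (s≤s z≤n)))

  1≤h[+n] : ∀ n → 1ℤ ℤ.≤ h (+ n)
  1≤h[+n] = <-rec (λ n → 1ℤ ℤ.≤ h (+ n)) positive
    where
    below : ∀ {k} → (∀ {i} → i < k → 1ℤ ℤ.≤ h (+ i)) → ∀ {m} → m ℤ.< + k → 1ℤ ℤ.≤ h m
    below ih {+ i}      (+<+ i<k) = ih i<k
    below ih { -[1+ i ]} _         = ℤₚ.≤-reflexive (sym (base _ -≤+))

    positive : ∀ n → (∀ {i} → i < n → 1ℤ ℤ.≤ h (+ i)) → 1ℤ ℤ.≤ h (+ n)
    positive 0             _  = ℤₚ.≤-reflexive (sym (base _ (+≤+ z≤n)))
    positive 1             _  = ℤₚ.≤-reflexive (sym (base _ ℤₚ.≤-refl))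
    positive (suc (suc n)) ih = subst (1ℤ ℤ.≤_) (sym (h-step n))
      (ℤₚ.≤-trans (+≤+ (s≤s z≤n)) (ℤₚ.+-mono-≤ (below ih jump<) (ih (m<n⇒m<1+n (n<1+n n)))))
      where
      jump< : + (2 + n) ℤ.- h (+ (1 + n)) ℤ.< + (2 + n)
      jump< = ℤₚ.≤-<-trans (-‿monoʳ-≥-≤ (+ (2 + n)) (ih ≤-refl)) (+<+ ≤-refl)

  1≤h : ∀ m → 1ℤ ℤ.≤ h m
  1≤h (+ n)     = 1≤h[+n] n
  1≤h -[1+ n ] = ℤₚ.≤-reflexive (sym (base _ -≤+))

  2≤h[2+n] : ∀ n → + 2 ℤ.≤ h (+ (2 + n))
  2≤h[2+n] n = subst (+ 2 ℤ.≤_) (sym (h-step n)) (ℤₚ.+-mono-≤ (1≤h _) (1≤h _))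

  h-even-step : ∀ k → h (+ (1 + 2 * k)) ≡ + (1 + k) →
                h (+ (2 * suc k)) ≡ h (+ suc k) ℤ.+ h (+ (2 * k))
  h-even-step k odd = begin
    h (+ (2 * suc k))                                              ≡⟨ cong (h ∘ +_) (*-suc 2 k) ⟩
    h (+ (2 + 2 * k))                                              ≡⟨ h-step (2 * k) ⟩
    h (+ (2 + 2 * k) ℤ.- h (+ (1 + 2 * k))) ℤ.+ h (+ (2 * k))      ≡⟨ cong (λ x → h (+ (2 + 2 * k) ℤ.- x) ℤ.+ h (+ (2 * k))) odd ⟩
    h (+ (2 + 2 * k) ℤ.- + (1 + k)) ℤ.+ h (+ (2 * k))              ≡⟨ cong (λ i → h i ℤ.+ h (+ (2 * k))) jump ⟩
    h (+ suc k) ℤ.+ h (+ (2 * k))                                  ∎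
    where
    open ≡-Reasoning
    double : ∀ k → 2 + 2 * k ≡ (1 + k) + (1 + k)
    double = solve-∀
    jump : + (2 + 2 * k) ℤ.- + (1 + k) ≡ + (1 + k)
    jump = trans (cong (λ n → + n ℤ.- + (1 + k)) (double k)) (+[m+n]-+n≡+m (1 + k) (1 + k))

  h-odd-step : ∀ k → h (+ (1 + 2 * k)) ≡ + (1 + k) → + (2 * suc k) ℤ.≤ h (+ (2 * suc k)) →
               h (+ (1 + 2 * suc k)) ≡ + (2 + k)
  h-odd-step k odd even rewrite *-suc 2 k = begin
    h (+ (3 + 2 * k))                                              ≡⟨ h-step (1 + 2 * k) ⟩
    h (+ (3 + 2 * k) ℤ.- h (+ (2 + 2 * k))) ℤ.+ h (+ (1 + 2 * k))  ≡⟨ cong₂ ℤ._+_ (base _ jump≤1) odd ⟩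
    1ℤ ℤ.+ + (1 + k)                                               ∎
    where
    open ≡-Reasoning
    jump≤1 : + (3 + 2 * k) ℤ.- h (+ (2 + 2 * k)) ℤ.≤ 1ℤ
    jump≤1 = ℤₚ.≤-trans (-‿monoʳ-≥-≤ (+ (3 + 2 * k)) even) (ℤₚ.≤-reflexive (+[m+n]-+n≡+m 1 (2 + 2 * k)))

  h-even-bound : ∀ k → h (+ (1 + 2 * k)) ≡ + (1 + k) → + (2 * k) ℤ.≤ h (+ (2 * k)) →
                 + (2 * suc k) ℤ.≤ h (+ (2 * suc k))
  h-even-bound zero    _   _    = 2≤h[2+n] 0
  h-even-bound (suc k) odd even = begin
    + (2 * suc (suc k))                ≡⟨ cong +_ (*-suc 2 (suc k)) ⟩
    + 2 ℤ.+ + (2 * suc k)              ≤⟨ ℤₚ.+-mono-≤ (2≤h[2+n] k) even ⟩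
    h (+ (2 + k)) ℤ.+ h (+ (2 * suc k)) ≡⟨ h-even-step (suc k) odd ⟨
    h (+ (2 * suc (suc k)))            ∎
    where open ℤₚ.≤-Reasoning

  h-odd-even : ∀ k → h (+ (1 + 2 * k)) ≡ + (1 + k) × + (2 * k) ℤ.≤ h (+ (2 * k))
  h-odd-even zero    = base _ ℤₚ.≤-refl , ℤₚ.≤-trans (+≤+ z≤n) (1≤h _)
  h-odd-even (suc k) = h-odd-step k odd even′ , even′
    where
    odd : h (+ (1 + 2 * k)) ≡ + (1 + k)
    odd = proj₁ (h-odd-even k)
    even′ : + (2 * suc k) ℤ.≤ h (+ (2 * suc k))
    even′ = h-even-bound k odd (proj₂ (h-odd-even k))

  h-even-suc : ∀ k → h (+ (2 * suc k)) ≡ h (+ suc k) ℤ.+ h (+ (2 * k))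
  h-even-suc k = h-even-step k (proj₁ (h-odd-even k))

  hℕ : ℕ → ℕ
  hℕ n = ∣ h (+ n) ∣

  +hℕ≡h : ∀ n → + hℕ n ≡ h (+ n)
  +hℕ≡h n = ℤₚ.0≤i⇒+∣i∣≡i (ℤₚ.≤-trans (+≤+ z≤n) (1≤h _))

  1≤hℕ : ∀ n → 1 ≤ hℕ n
  1≤hℕ n = ℤₚ.drop‿+≤+ (subst (1ℤ ℤ.≤_) (sym (+hℕ≡h n)) (1≤h _))

  hEven : ℕ → ℕ
  hEven k = hℕ (2 * k)

  hEven-suc : ∀ k → hEven (suc k) ≡ hℕ (suc k) + hEven k
  hEven-suc k = ℤₚ.+-injective (begin
    + hEven (suc k)                   ≡⟨ +hℕ≡h (2 * suc k) ⟩
    h (+ (2 * suc k))                 ≡⟨ h-even-suc k ⟩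
    h (+ suc k) ℤ.+ h (+ (2 * k))     ≡⟨ cong₂ ℤ._+_ (+hℕ≡h (suc k)) (+hℕ≡h (2 * k)) ⟨
    + hℕ (suc k) ℤ.+ + hEven k        ∎)
    where open ≡-Reasoning

  hEven-strict : ∀ k → hEven k < hEven (suc k)
  hEven-strict k = subst (hEven k <_) (sym (hEven-suc k)) (+-monoˡ-≤ (hEven k) (1≤hℕ (suc k)))

  hEven-doubling : ∀ m → hEven (suc m) + hEven (2 * m) ≤ hEven (2 * suc m)
  hEven-doubling m = begin
    hEven (suc m) + hEven (2 * m)                         ≡⟨ cong (λ n → hℕ n + hEven (2 * m)) (*-suc 2 m) ⟩
    hℕ (2 + 2 * m) + hEven (2 * m)                        ≤⟨ +-monoʳ-≤ (hℕ (2 + 2 * m)) (m≤n+m _ (hℕ (1 + 2 * m))) ⟩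
    hℕ (2 + 2 * m) + (hℕ (1 + 2 * m) + hEven (2 * m))     ≡⟨ cong₂ _+_ refl (hEven-suc (2 * m)) ⟨
    hℕ (2 + 2 * m) + hEven (1 + 2 * m)                    ≡⟨ hEven-suc (1 + 2 * m) ⟨
    hEven (2 + 2 * m)                                     ≡⟨ cong hEven (*-suc 2 m) ⟨
    hEven (2 * suc m)                                     ∎
    where open ≤-Reasoning

  hEven-superpolynomial : Superpolynomial hEven
  hEven-superpolynomial = superpolynomial hEven hEven-strict hEven-doubling

corollary3p4 : ∀ (h : ℤ → ℤ) → IsH h →
    ¬ (Σ Poly λ P → InfinitelyMany (λ n → h (+ (2 * n)) ≡ eval P (+ n)))
corollary3p4 h isH (P , often) = <⇒≱ (dominated n N≤n) (ℤₚ.drop‿+≤+ hEven≤bound)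
  where
  open Properties isH
  N : ℕ
  N = proj₁ (hEven-superpolynomial (length P) (norm₁ P))
  dominated : ∀ n → N ≤ n → norm₁ P * suc n ^ length P < hEven n
  dominated = proj₂ (hEven-superpolynomial (length P) (norm₁ P))
  n : ℕ
  n = proj₁ (often N)
  N≤n : N ≤ n
  N≤n = proj₁ (proj₂ (often N))
  hEven≤bound : + hEven n ℤ.≤ + (norm₁ P * suc n ^ length P)
  hEven≤bound = begin
    + hEven n                         ≡⟨ +hℕ≡h (2 * n) ⟩
    h (+ (2 * n))                     ≡⟨ proj₂ (proj₂ (often N)) ⟩
    eval P (+ n)                      ≤⟨ eval≤evalAbs P n ⟩
    + evalAbs P n                     ≤⟨ +≤+ (evalAbs≤norm₁*[1+n]^deg P n) ⟩
    + (norm₁ P * suc n ^ length P)    ∎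
    where open ℤₚ.≤-Reasoning
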